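{- For integers $n\geq 0$ and $k$ let $a(n,k)=\binom{n}{k}^2\binom{2n-2k}{n-k}$ (with $\binom{m}{j}=0$ if $j<0$ or $j>m$), and for $n\geq 1$, $0\leq t\leq n$, $0\leq k\leq t/2$ let $$\mathcal{L}_t(a(n,k))=a(n+1,k)a(n-1,t-k)+a(n-1,k)a(n+1,t-k)-2a(n,k)a(n,t-k).$$ Then for every $n\geq 1$ and every integer $0\leq t\leq n$ we have $\mathcal{L}_t(a(n,0))\geq 0$.
   Context: All of $n,t,k$ are nonnegative integers. Binomial coefficients $\binom{m}{j}$ are taken to be $0$ when $j<0$ or $j>m$. -}

module Defs where

open import Data.Nat using (ℕ; suc; _∸_; _*_; _^_)
open import Data.Nat.Combinatorics using (_C_)
open import Data.Integer as ℤ using (ℤ; +_)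

-- a(n,k) = binom(n,k)^2 * binom(2n-2k, n-k), for natural n, k.
-- (For k > n, binom(n,k) = 0 so a(n,k) = 0, matching the convention;
--  truncated subtraction is then harmless.)
a : ℕ → ℕ → ℕ
a n k = (n C k) ^ 2 * ((2 * n ∸ 2 * k) C (n ∸ k))

-- L_t(a(n,k)) for n ≥ 1, written with m = n - 1 (so n = suc m), as an integer.
L : ℕ → ℕ → ℕ → ℤ
L m t k =
  (+ (a (suc (suc m)) k * a m (t ∸ k)) ℤ.+ + (a m k * a (suc (suc m)) (t ∸ k)))
  ℤ.- + (2 * (a (suc m) k * a (suc m) (t ∸ k)))

module Submission where

-- Write n = m + 1 and c(s) = C(2s, s) for the central binomial coefficients.
-- Since a(n, 0) = c(n), the claim L_t(a(n, 0)) ≥ 0 reads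
--     2 c(n) a(n, t) ≤ c(n + 1) a(n - 1, t) + c(n - 1) a(n + 1, t).
-- For t ≤ n - 1 put M = n - 1 and U = M - t, so that a(M + i, t) = C(M + i, t)² c(U + i)
-- for i = 0, 1, 2.  All nine quantities c(M + i), C(M + i, t), c(U + i) are tied to
-- their i = 0 values by the two ratio laws
--     (s + 1) C(t + s + 1, t) = (t + s + 1) C(t + s, t),   (s + 1) c(s + 1) = 2(2s + 1) c(s).
-- Clearing the denominators (M+1)(M+2)((U+1)(U+2))³ therefore turns the claim into a
-- polynomial inequality lower(M, U) ≤ upper(M, U), which holds whenever U ≤ M: for M = U
-- the difference factors, for M > U it has nonnegative coefficients in U and M - U - 1.
-- The remaining case t = n is a single ratio estimate for c.

open import Defs
open import Data.Nat using (ℕ; suc; zero; _≤_; _+_; _*_; _∸_; s≤s)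
open import Data.Nat.Properties
open import Data.Nat.Combinatorics using (_C_; nCn≡1; nC1≡n; nCk≡nC[n∸k]; nCk+nC[k+1]≡[n+1]C[k+1])
open import Data.Nat.Tactic.RingSolver using (solve-∀)
open import Data.Integer using (0ℤ) renaming (_≤_ to _≤ℤ_)
import Data.Integer as ℤ
import Data.Integer.Properties as ℤ
open import Data.Product using (_,_)
open import Data.Sum using (inj₁; inj₂)
open import Relation.Binary.PropositionalEquality
open import Algebra.Properties.CommutativeSemigroup *-commutativeSemigroup using (x∙yz≈y∙xz; interchange)

absorption : ∀ n k → suc k * (suc n C suc k) ≡ suc n * (n C k)
absorption n       zero    = trans (*-identityˡ _) (trans (nC1≡n (suc n)) (sym (*-identityʳ _)))
absorption zero    (suc k) = *-zeroʳ (suc (suc k))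
absorption (suc n) (suc k) = begin
  suc (suc k) * (suc (suc n) C suc (suc k))      ≡⟨ cong (suc (suc k) *_) (sym (nCk+nC[k+1]≡[n+1]C[k+1] (suc n) (suc k))) ⟩
  suc (suc k) * (X + suc n C suc (suc k))        ≡⟨ *-distribˡ-+ (suc (suc k)) X _ ⟩
  X + suc k * X + suc (suc k) * (suc n C suc (suc k))
    ≡⟨ cong₂ (λ p q → X + p + q) (absorption n k) (absorption n (suc k)) ⟩
  X + suc n * (n C k) + suc n * (n C suc k)      ≡⟨ +-assoc X _ _ ⟩
  X + (suc n * (n C k) + suc n * (n C suc k))    ≡⟨ cong (X +_) (sym (*-distribˡ-+ (suc n) (n C k) (n C suc k))) ⟩
  X + suc n * (n C k + n C suc k)                ≡⟨ cong (λ z → X + suc n * z) (nCk+nC[k+1]≡[n+1]C[k+1] n k) ⟩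
  suc (suc n) * X                                ∎
  where
  open ≡-Reasoning
  X : ℕ
  X = suc n C suc k

symmetry : ∀ i j → (i + j) C i ≡ (i + j) C j
symmetry i j = trans (nCk≡nC[n∸k] (m≤m+n i j)) (cong ((i + j) C_) (m+n∸m≡n i j))

-- Ratio law along a column t: (s + 1) C(t + s + 1, t) = (t + s + 1) C(t + s, t).
-- By symmetry it is the absorption identity for C(t + s + 1, s + 1).
column-step : ∀ {n} t s → n ≡ t + s → suc s * (suc n C t) ≡ suc n * (n C t)
column-step t s refl = begin
  suc s * (suc (t + s) C t)        ≡⟨ cong (λ n → suc s * (n C t)) (sym (+-suc t s)) ⟩
  suc s * ((t + suc s) C t)        ≡⟨ cong (suc s *_) (symmetry t (suc s)) ⟩
  suc s * ((t + suc s) C suc s)    ≡⟨ cong (λ n → suc s * (n C suc s)) (+-suc t s) ⟩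
  suc s * (suc (t + s) C suc s)    ≡⟨ absorption (t + s) s ⟩
  suc (t + s) * ((t + s) C s)      ≡⟨ cong (suc (t + s) *_) (sym (symmetry t s)) ⟩
  suc (t + s) * ((t + s) C t)      ∎
  where open ≡-Reasoning

central : ℕ → ℕ
central s = (2 * s) C s

-- Ratio law (s + 1) c(s + 1) = 2(2s + 1) c(s); after multiplying by s + 1 it is
-- absorption followed by the column law for C(2s + 1, s).
central-step : ∀ s → suc s * central (suc s) ≡ 2 * suc (2 * s) * central s
central-step s = *-cancelˡ-≡ _ _ (suc s) (begin
  suc s * (suc s * ((2 * suc s) C suc s))          ≡⟨ cong (λ n → suc s * (suc s * (n C suc s))) (*-suc 2 s) ⟩
  suc s * (suc s * (suc (suc (2 * s)) C suc s))    ≡⟨ cong (suc s *_) (absorption (suc (2 * s)) s) ⟩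
  suc s * (suc (suc (2 * s)) * (suc (2 * s) C s))  ≡⟨ x∙yz≈y∙xz (suc s) (suc (suc (2 * s))) (suc (2 * s) C s) ⟩
  suc (suc (2 * s)) * (suc s * (suc (2 * s) C s))  ≡⟨ cong (suc (suc (2 * s)) *_) column-step-diagonal ⟩
  suc (suc (2 * s)) * (suc (2 * s) * central s)    ≡⟨ regroup s (central s) ⟩
  suc s * (2 * suc (2 * s) * central s)            ∎)
  where
  open ≡-Reasoning
  regroup : ∀ s c → suc (suc (2 * s)) * (suc (2 * s) * c) ≡ suc s * (2 * suc (2 * s) * c)
  regroup = solve-∀
  twice : 2 * s ≡ s + s
  twice = cong (s +_) (+-identityʳ s)
  column-step-diagonal : suc s * (suc (2 * s) C s) ≡ suc (2 * s) * central s
  column-step-diagonal = column-step s s twice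

-- Squares and cubes as products (the ring solver does not handle _^_).
square cube : ℕ → ℕ
square x = x * x
cube x = x * x * x

a-zero : ∀ n → a n 0 ≡ central n
a-zero n = +-identityʳ (central n)

a-column : ∀ {n} t s → n ≡ t + s → a n t ≡ square (n C t) * central s
a-column t s refl = cong₂ _*_ (cong (x *_) (*-identityʳ x)) (cong₂ _C_ top (m+n∸m≡n t s))
  where
  x : ℕ
  x = (t + s) C t
  top : 2 * (t + s) ∸ 2 * t ≡ 2 * s
  top = trans (cong (_∸ 2 * t) (*-distribˡ-+ 2 t s)) (m+n∸m≡n (2 * t) (2 * s))

ratio-compose : ∀ {x y z} x₁ x₂ r₁ r₂ → x₁ * y ≡ r₁ * x → x₂ * z ≡ r₂ * y → (x₁ * x₂) * z ≡ (r₁ * r₂) * x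
ratio-compose {x} {y} {z} x₁ x₂ r₁ r₂ h₁ h₂ = begin
  (x₁ * x₂) * z    ≡⟨ *-assoc x₁ x₂ z ⟩
  x₁ * (x₂ * z)    ≡⟨ cong (x₁ *_) h₂ ⟩
  x₁ * (r₂ * y)    ≡⟨ x∙yz≈y∙xz x₁ r₂ y ⟩
  r₂ * (x₁ * y)    ≡⟨ cong (r₂ *_) h₁ ⟩
  r₂ * (r₁ * x)    ≡⟨ sym (x∙yz≈y∙xz r₁ r₂ x) ⟩
  r₁ * (r₂ * x)    ≡⟨ sym (*-assoc r₁ r₂ x) ⟩
  (r₁ * r₂) * x    ∎
  where
  open ≡-Reasoning

-- The polynomials left after clearing denominators: with rise N = (N+1)(N+2) and
-- double-step N = 2(2N+1)·2(2N+3) (so rise N · c(N+2) = double-step N · c(N)),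
-- the two sides of the claim become lower M U and upper M U times c(M) C(M, t)² c(U).
rise : ℕ → ℕ
rise N = suc N * suc (suc N)

double-step : ℕ → ℕ
double-step N = 2 * suc (2 * N) * (2 * suc (2 * suc N))

upper : ℕ → ℕ → ℕ
upper M U = double-step M * cube (rise U) + cube (rise M) * double-step U

lower : ℕ → ℕ → ℕ
lower M U = 2 * suc (suc M) * cube (suc (suc U)) * (2 * suc (2 * M)) * square (suc M) * (2 * suc (2 * U))

-- P, Q, c stand for C(M + i, t), c(U + i), c(M + i) (i = 0, 1, 2), and the
-- hypotheses are the ratio laws between them.  Multiplying the claim by
-- rise M · rise U³ expresses every term as a polynomial multiple of c₀ P₀² Q₀.
reduction : ∀ M U {P₀ P₁ P₂ Q₀ Q₁ Q₂ c₀ c₁ c₂} →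
  suc U * P₁ ≡ suc M * P₀ → suc (suc U) * P₂ ≡ suc (suc M) * P₁ →
  suc U * Q₁ ≡ 2 * suc (2 * U) * Q₀ → suc (suc U) * Q₂ ≡ 2 * suc (2 * suc U) * Q₁ →
  suc M * c₁ ≡ 2 * suc (2 * M) * c₀ → suc (suc M) * c₂ ≡ 2 * suc (2 * suc M) * c₁ →
  lower M U ≤ upper M U →
  2 * (c₁ * (square P₁ * Q₁)) ≤ c₂ * (square P₀ * Q₀) + c₀ * (square P₂ * Q₂)
reduction M U {P₀} {P₁} {P₂} {Q₀} {Q₁} {Q₂} {c₀} {c₁} {c₂} hP₁ hP₂ hQ₁ hQ₂ hc₁ hc₂ polynomial-bound =
  *-cancelˡ-≤ {2 * (c₁ * (square P₁ * Q₁))} {c₂ * (square P₀ * Q₀) + c₀ * (square P₂ * Q₂)} denominator (begin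
    denominator * (2 * (c₁ * (square P₁ * Q₁)))  ≡⟨ middle-term ⟩
    lower M U * base                             ≤⟨ *-monoˡ-≤ base polynomial-bound ⟩
    upper M U * base
      ≡⟨ *-distribʳ-+ base (double-step M * cube (rise U)) (cube (rise M) * double-step U) ⟩
    double-step M * cube (rise U) * base + cube (rise M) * double-step U * base
      ≡⟨ sym (cong₂ _+_ outer-term-c₂ outer-term-c₀) ⟩
    denominator * (c₂ * (square P₀ * Q₀)) + denominator * (c₀ * (square P₂ * Q₂))
      ≡⟨ sym (*-distribˡ-+ denominator (c₂ * (square P₀ * Q₀)) (c₀ * (square P₂ * Q₂))) ⟩
    denominator * (c₂ * (square P₀ * Q₀) + c₀ * (square P₂ * Q₂))  ∎)
  where
  open ≤-Reasoning
  denominator base : ℕ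
  denominator = rise M * cube (rise U)
  base = c₀ * (square P₀ * Q₀)

  P₂-by-P₀ : rise U * P₂ ≡ rise M * P₀
  P₂-by-P₀ = ratio-compose {P₀} {P₁} {P₂} (suc U) (suc (suc U)) (suc M) (suc (suc M)) hP₁ hP₂
  Q₂-by-Q₀ : rise U * Q₂ ≡ double-step U * Q₀
  Q₂-by-Q₀ = ratio-compose {Q₀} {Q₁} {Q₂} (suc U) (suc (suc U)) (2 * suc (2 * U)) (2 * suc (2 * suc U)) hQ₁ hQ₂
  c₂-by-c₀ : rise M * c₂ ≡ double-step M * c₀
  c₂-by-c₀ = ratio-compose {c₀} {c₁} {c₂} (suc M) (suc (suc M)) (2 * suc (2 * M)) (2 * suc (2 * suc M)) hc₁ hc₂

  regroup-c₂ : ∀ r u c W → r * u * (c * W) ≡ r * c * (u * W)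
  regroup-c₂ = solve-∀
  regroup-c₀ : ∀ r u c P Q → r * (u * u * u) * (c * (P * P * Q)) ≡ r * c * ((u * P) * (u * P) * (u * Q))
  regroup-c₀ = solve-∀
  collect-c₀ : ∀ r d c P Q → r * c * ((r * P) * (r * P) * (d * Q)) ≡ r * r * r * d * (c * (P * P * Q))
  collect-c₀ = solve-∀
  regroup-c₁ : ∀ m₁ m₂ u₁ u₂ c P Q →
    m₁ * m₂ * ((u₁ * u₂) * (u₁ * u₂) * (u₁ * u₂)) * (2 * (c * (P * P * Q)))
      ≡ 2 * m₂ * (u₂ * u₂ * u₂) * (m₁ * c * ((u₁ * P) * (u₁ * P) * (u₁ * Q)))
  regroup-c₁ = solve-∀
  collect-c₁ : ∀ m₁ m₂ u₂ γ κ c P Q →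
    2 * m₂ * (u₂ * u₂ * u₂) * (γ * c * ((m₁ * P) * (m₁ * P) * (κ * Q)))
      ≡ 2 * m₂ * (u₂ * u₂ * u₂) * γ * (m₁ * m₁) * κ * (c * (P * P * Q))
  collect-c₁ = solve-∀

  outer-term-c₂ : denominator * (c₂ * (square P₀ * Q₀)) ≡ double-step M * cube (rise U) * base
  outer-term-c₂ = begin-equality
    denominator * (c₂ * (square P₀ * Q₀))
      ≡⟨ regroup-c₂ (rise M) (cube (rise U)) c₂ (square P₀ * Q₀) ⟩
    rise M * c₂ * (cube (rise U) * (square P₀ * Q₀))
      ≡⟨ cong (_* (cube (rise U) * (square P₀ * Q₀))) c₂-by-c₀ ⟩
    double-step M * c₀ * (cube (rise U) * (square P₀ * Q₀))
      ≡⟨ interchange (double-step M) c₀ (cube (rise U)) (square P₀ * Q₀) ⟩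
    double-step M * cube (rise U) * base ∎

  outer-term-c₀ : denominator * (c₀ * (square P₂ * Q₂)) ≡ cube (rise M) * double-step U * base
  outer-term-c₀ = begin-equality
    denominator * (c₀ * (square P₂ * Q₂))
      ≡⟨ regroup-c₀ (rise M) (rise U) c₀ P₂ Q₂ ⟩
    rise M * c₀ * (square (rise U * P₂) * (rise U * Q₂))
      ≡⟨ cong₂ (λ p q → rise M * c₀ * (square p * q)) P₂-by-P₀ Q₂-by-Q₀ ⟩
    rise M * c₀ * (square (rise M * P₀) * (double-step U * Q₀))
      ≡⟨ collect-c₀ (rise M) (double-step U) c₀ P₀ Q₀ ⟩
    cube (rise M) * double-step U * base ∎

  middle-term : denominator * (2 * (c₁ * (square P₁ * Q₁))) ≡ lower M U * base
  middle-term = begin-equality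
    denominator * (2 * (c₁ * (square P₁ * Q₁)))
      ≡⟨ regroup-c₁ (suc M) (suc (suc M)) (suc U) (suc (suc U)) c₁ P₁ Q₁ ⟩
    2 * suc (suc M) * cube (suc (suc U)) * (suc M * c₁ * (square (suc U * P₁) * (suc U * Q₁)))
      ≡⟨ cong₂ (λ x y → 2 * suc (suc M) * cube (suc (suc U)) * (x * y)) hc₁ (cong₂ (λ p q → square p * q) hP₁ hQ₁) ⟩
    2 * suc (suc M) * cube (suc (suc U)) * (2 * suc (2 * M) * c₀ * (square (suc M * P₀) * (2 * suc (2 * U) * Q₀)))
      ≡⟨ collect-c₁ (suc M) (suc (suc M)) (suc (suc U)) (2 * suc (2 * M)) (2 * suc (2 * U)) c₀ P₀ Q₀ ⟩
    lower M U * base ∎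

-- Both cases are identities
-- lower + surplus = upper with a manifestly nonnegative surplus: 8(2U+1)(U+1)²(U+2)³
-- for t = 0, and a polynomial in e and U with positive coefficients for t = e + 1.
-- The identities are stated with lower and upper unfolded, as the ring solver needs.
lower≤upper : ∀ t U → lower (t + U) U ≤ upper (t + U) U
lower≤upper zero    U = subst (lower U U ≤_) (on-diagonal U) (m≤m+n _ _)
  where
  on-diagonal : ∀ U →
    2 * suc (suc U) * (suc (suc U) * suc (suc U) * suc (suc U)) * (2 * suc (2 * U)) * (suc U * suc U) * (2 * suc (2 * U))
    + 8 * suc (2 * U) * (suc U * suc U) * (suc (suc U) * suc (suc U) * suc (suc U))
    ≡ (2 * suc (2 * U) * (2 * suc (2 * suc U))) * ((suc U * suc (suc U)) * (suc U * suc (suc U)) * (suc U * suc (suc U)))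
      + (suc U * suc (suc U)) * (suc U * suc (suc U)) * (suc U * suc (suc U)) * (2 * suc (2 * U) * (2 * suc (2 * suc U)))
  on-diagonal = solve-∀
lower≤upper (suc e) U = subst (lower (suc (e + U)) U ≤_) (off-diagonal e U) (m≤m+n _ _)
  where
  off-diagonal : ∀ e U →
    2 * suc (suc (suc (e + U))) * (suc (suc U) * suc (suc U) * suc (suc U)) * (2 * suc (2 * suc (e + U)))
      * (suc (suc (e + U)) * suc (suc (e + U))) * (2 * suc (2 * U))
    + (768 + 2384 * e + 3432 * e * e + 2572 * e * e * e + 988 * e * e * e * e + 180 * e * e * e * e * e + 12 * e * e * e * e * e * e
       + 3392 * U + 10320 * U * e + 14276 * U * e * e + 9904 * U * e * e * e + 3428 * U * e * e * e * e + 552 * U * e * e * e * e * e + 32 * U * e * e * e * e * e * e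
       + 5664 * U * U + 16420 * U * U * e + 21048 * U * U * e * e + 12712 * U * U * e * e * e + 3588 * U * U * e * e * e * e + 432 * U * U * e * e * e * e * e + 16 * U * U * e * e * e * e * e * e
       + 4752 * U * U * U + 12880 * U * U * U * e + 14864 * U * U * U * e * e + 7304 * U * U * U * e * e * e + 1472 * U * U * U * e * e * e * e + 96 * U * U * U * e * e * e * e * e
       + 2152 * U * U * U * U + 5364 * U * U * U * U * e + 5404 * U * U * U * U * e * e + 1936 * U * U * U * U * e * e * e + 208 * U * U * U * U * e * e * e * e
       + 504 * U * U * U * U * U + 1136 * U * U * U * U * U * e + 960 * U * U * U * U * U * e * e + 192 * U * U * U * U * U * e * e * e
       + 48 * U * U * U * U * U * U + 96 * U * U * U * U * U * U * e + 64 * U * U * U * U * U * U * e * e)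
    ≡ (2 * suc (2 * suc (e + U)) * (2 * suc (2 * suc (suc (e + U)))))
        * ((suc U * suc (suc U)) * (suc U * suc (suc U)) * (suc U * suc (suc U)))
      + (suc (suc (e + U)) * suc (suc (suc (e + U)))) * (suc (suc (e + U)) * suc (suc (suc (e + U))))
        * (suc (suc (e + U)) * suc (suc (suc (e + U)))) * (2 * suc (2 * U) * (2 * suc (2 * suc U)))
  off-diagonal = solve-∀

below-diagonal : ∀ t u →
  2 * (a (suc (t + u)) 0 * a (suc (t + u)) t) ≤ a (suc (suc (t + u))) 0 * a (t + u) t + a (t + u) 0 * a (suc (suc (t + u))) t
below-diagonal t u = begin
  2 * (a (suc M) 0 * a (suc M) t)
    ≡⟨ cong₂ (λ x y → 2 * (x * y)) (a-zero (suc M)) (a-column t (suc u) M+1≡t+[u+1]) ⟩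
  2 * (central (suc M) * (square P₁ * central (suc u)))
    ≤⟨ reduction M u {P₀} {P₁} {P₂} {central u} {central (suc u)} {central (suc (suc u))}
                     {central M} {central (suc M)} {central (suc (suc M))}
                     (column-step t u refl) (column-step t (suc u) M+1≡t+[u+1])
                     (central-step u) (central-step (suc u)) (central-step M) (central-step (suc M))
                     (lower≤upper t u) ⟩
  central (suc (suc M)) * (square P₀ * central u) + central M * (square P₂ * central (suc (suc u)))
    ≡⟨ sym (cong₂ _+_ (cong₂ _*_ (a-zero (suc (suc M))) (a-column t u refl))
                      (cong₂ _*_ (a-zero M) (a-column t (suc (suc u)) M+2≡t+[u+2]))) ⟩
  a (suc (suc M)) 0 * a M t + a M 0 * a (suc (suc M)) t ∎
  where
  open ≤-Reasoning
  M P₀ P₁ P₂ : ℕ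
  M = t + u
  P₀ = M C t
  P₁ = suc M C t
  P₂ = suc (suc M) C t
  M+1≡t+[u+1] : suc M ≡ t + suc u
  M+1≡t+[u+1] = sym (+-suc t u)
  M+2≡t+[u+2] : suc (suc M) ≡ t + suc (suc u)
  M+2≡t+[u+2] = trans (cong suc M+1≡t+[u+1]) (sym (+-suc t (suc u)))

-- Growth bound c(m + 1) ≤ (m + 2)² c(m), from the ratio law and 2(2m + 1) ≤ (m + 1)(m + 2)².
central-growth : ∀ m → central (suc m) ≤ square (suc (suc m)) * central m
central-growth m = *-cancelˡ-≤ (suc m) (begin
  suc m * central (suc m)                  ≡⟨ central-step m ⟩
  2 * suc (2 * m) * central m              ≤⟨ *-monoˡ-≤ (central m) ratio-bound ⟩
  suc m * square (suc (suc m)) * central m ≡⟨ *-assoc (suc m) (square (suc (suc m))) (central m) ⟩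
  suc m * (square (suc (suc m)) * central m) ∎)
  where
  open ≤-Reasoning
  identity : ∀ m → 2 * suc (2 * m) + (m * m * m + 5 * m * m + 4 * m + 2) ≡ suc m * (suc (suc m) * suc (suc m))
  identity = solve-∀
  ratio-bound : 2 * suc (2 * m) ≤ suc m * square (suc (suc m))
  ratio-bound = subst (2 * suc (2 * m) ≤_) (identity m) (m≤m+n _ _)

-- The case t = n: a(n - 1, n) = 0 drops out, a(n, n) = 1 and a(n + 1, n) = 2(n + 1)²,
-- so the claim is 2 c(n) ≤ 2 (n + 1)² c(n - 1), the growth bound.
diagonal : ∀ m →
  2 * (a (suc m) 0 * a (suc m) (suc m)) ≤ a (suc (suc m)) 0 * a m (suc m) + a m 0 * a (suc (suc m)) (suc m)
diagonal m = begin
  2 * (a (suc m) 0 * a (suc m) (suc m))    ≡⟨ cong₂ (λ x y → 2 * (x * y)) (a-zero (suc m)) a-self ⟩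
  2 * (central (suc m) * 1)                ≡⟨ cong (2 *_) (*-identityʳ (central (suc m))) ⟩
  2 * central (suc m)                      ≤⟨ *-monoʳ-≤ 2 (central-growth m) ⟩
  2 * (square (suc (suc m)) * central m)   ≡⟨ regroup (square (suc (suc m))) (central m) ⟩
  central m * (square (suc (suc m)) * 2)   ≡⟨ cong₂ _*_ (sym (a-zero m)) (sym a-next) ⟩
  a m 0 * a (suc (suc m)) (suc m)          ≤⟨ m≤n+m _ _ ⟩
  a (suc (suc m)) 0 * a m (suc m) + a m 0 * a (suc (suc m)) (suc m) ∎
  where
  open ≤-Reasoning
  regroup : ∀ s c → 2 * (s * c) ≡ c * (s * 2)
  regroup = solve-∀
  a-self : a (suc m) (suc m) ≡ 1
  a-self = trans (a-column (suc m) 0 (sym (+-identityʳ (suc m)))) (cong (λ x → square x * central 0) (nCn≡1 (suc m)))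
  C-below-diagonal : suc (suc m) C suc m ≡ suc (suc m)
  C-below-diagonal = subst (λ n → n C suc m ≡ n) (+-comm (suc m) 1) (trans (symmetry (suc m) 1) (nC1≡n (suc m + 1)))
  a-next : a (suc (suc m)) (suc m) ≡ square (suc (suc m)) * 2
  a-next = trans (a-column (suc m) 1 (+-comm 1 (suc m))) (cong (λ x → square x * central 1) C-below-diagonal)

L-nonnegative-ℕ : ∀ m t → t ≤ suc m →
  2 * (a (suc m) 0 * a (suc m) t) ≤ a (suc (suc m)) 0 * a m t + a m 0 * a (suc (suc m)) t
L-nonnegative-ℕ m t t≤n with m≤n⇒m<n∨m≡n t≤n
... | inj₂ refl = diagonal m
... | inj₁ (s≤s t≤m) with m≤n⇒∃[o]m+o≡n t≤m
...   | u , refl = below-diagonal t u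

proposition3p3 : ∀ (m t : ℕ) → t ≤ suc m → 0ℤ ≤ℤ L m t 0
proposition3p3 m t t≤n = ℤ.i≤j⇒0≤j-i (ℤ.+≤+ (L-nonnegative-ℕ m t t≤n))
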